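{- Let $w\in\mathfrak S_n$. The intersection (as sets of positions) of a maximal $k$-ascending section and a maximal $k$-descending section of $w$ is empty or consists of a single element. Two distinct maximal $k$-ascending sections of $w$ do not intersect.
   Context: Let $n\ge2$, $1\le k\le n-1$, and $\mathfrak S_n$ the permutations of $\{1,\dots,n\}$ in one-line notation $w=w_1\cdots w_n$. A section of $w$ is a consecutive segment $w_sw_{s+1}\cdots w_t$. A section $w_i\cdots w_j$ with $i<j$ is $k$-ascending if (1) $w_i=\min\{w_i,\dots,w_j\}$ and $w_j=\max\{w_i,\dots,w_j\}$; (2) $w_j-w_i\ge k$; (3) there are no $i\le s<t\le j$ with $w_s-w_t\ge k$. It is $k$-descending if (1) $w_i=\max\{w_i,\dots,w_j\}$ and $w_j=\min\{w_i,\dots,w_j\}$; (2) $w_i-w_j\ge k$; (3) there are no $i\le s<t\le j$ with $w_t-w_s\ge k$. A $k$-ascending (resp. $k$-descending) section is maximal if it is not contained in another $k$-ascending (resp. $k$-descending) section. -}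

module Defs where

open import Data.Nat using (ℕ; _+_; _∸_; _≤_; _<_; _≥_)
open import Data.Nat.Properties using (_<?_)
open import Data.Fin using (Fin; toℕ; fromℕ<)
open import Data.Fin.Permutation using (Permutation′; _⟨$⟩ʳ_)
open import Data.Product using (_×_; Σ; ∃)
open import Relation.Nullary using (¬_; yes; no)
open import Relation.Binary.PropositionalEquality using (_≡_)

-- A permutation w of {1..n}, in one-line notation w₁⋯wₙ, is represented by
-- a stdlib permutation of Fin n (positions 0..n-1, values 0..n-1; shifting
-- all values by 1 does not affect any of the notions below).
-- value of w at position p (0-based); 0 for out-of-range positions (never used)
val : {n : ℕ} → Permutation′ n → ℕ → ℕ
val {n} w p with p <? n
... | yes p<n = toℕ (w ⟨$⟩ʳ fromℕ< p<n)
... | no _    = 0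

-- A section is a pair of positions (i , j), meaning w_i ⋯ w_j.
-- Here we consider sections with i < j < n.

IsKAscending : {n : ℕ} → ℕ → Permutation′ n → ℕ → ℕ → Set
IsKAscending {n} k w i j =
  i < j × j < n
  × (∀ p → i ≤ p → p ≤ j → val w i ≤ val w p)
  × (∀ p → i ≤ p → p ≤ j → val w p ≤ val w j)
  × (val w j ≥ val w i + k)
  × (∀ s t → i ≤ s → s < t → t ≤ j → ¬ (val w s ≥ val w t + k))

IsKDescending : {n : ℕ} → ℕ → Permutation′ n → ℕ → ℕ → Set
IsKDescending {n} k w i j =
  i < j × j < n
  × (∀ p → i ≤ p → p ≤ j → val w p ≤ val w i)
  × (∀ p → i ≤ p → p ≤ j → val w j ≤ val w p)
  × (val w i ≥ val w j + k)
  × (∀ s t → i ≤ s → s < t → t ≤ j → ¬ (val w t ≥ val w s + k))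

IsMaxKAscending : {n : ℕ} → ℕ → Permutation′ n → ℕ → ℕ → Set
IsMaxKAscending k w i j =
  IsKAscending k w i j
  × (∀ i' j' → IsKAscending k w i' j' → i' ≤ i → j ≤ j' → (i' ≡ i × j' ≡ j))

IsMaxKDescending : {n : ℕ} → ℕ → Permutation′ n → ℕ → ℕ → Set
IsMaxKDescending k w i j =
  IsKDescending k w i j
  × (∀ i' j' → IsKDescending k w i' j' → i' ≤ i → j ≤ j' → (i' ≡ i × j' ≡ j))

InSection : ℕ → ℕ → ℕ → Set
InSection i j p = i ≤ p × p ≤ j

-- A k-ascending section has its minimum first, its maximum last and contains
-- no k-descent; dually for k-descending sections.  So neither kind fits inside
-- the other (its two ends would be a forbidden k-descent, resp. k-ascent).  If
-- an ascending section a..b and a descending one c..d cross, say a ≤ c ≤ b ≤ d,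
-- then w_b and w_c are each the maximum of a section containing the other, so
-- w_b = w_c, b = c and they share one position.  Overlapping k-ascending
-- sections glue to a k-ascending section, so two overlapping maximal ones both
-- coincide with their union.
module Submission where

open import Defs
open import Data.Nat using (ℕ; _≤_; _<_; _+_; _≥_; _≤?_)
open import Data.Nat.Properties
  using (≤-refl; ≤-trans; <-≤-trans; ≤-<-trans; <⇒≤; ≤-antisym; ≤-total;
         <-irrefl; <-cmp; ≰⇒>; +-monoˡ-≤; _<?_)
open import Data.Fin.Properties using (toℕ-injective; fromℕ<-injective)
open import Data.Fin.Permutation using (Permutation′)
open import Function.Bundles using (Injection)
open import Function.Properties.Inverse using (↔⇒↣)
open import Data.Product using (_×_; _,_)
open import Data.Sum using (inj₁; inj₂)
open import Data.Empty using (⊥; ⊥-elim)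
open import Relation.Nullary using (¬_; yes; no)
open import Relation.Binary.Definitions using (tri<; tri≈; tri>)
open import Relation.Binary.PropositionalEquality using (_≡_; sym)

val-injective : ∀ {n} (w : Permutation′ n) {i j} → i < n → j < n →
  val w i ≡ val w j → i ≡ j
val-injective {n} w {i} {j} i<n j<n eq with i <? n | j <? n
... | yes i<n′ | yes j<n′ =
  fromℕ<-injective i j i<n′ j<n′ (Injection.injective (↔⇒↣ w) (toℕ-injective eq))
... | no i≮n | _      = ⊥-elim (i≮n i<n)
... | yes _  | no j≮n = ⊥-elim (j≮n j<n)

module _ {n k : ℕ} (w : Permutation′ n) where

  kDescending-not-inside-kAscending : ∀ {a b c d} →
    IsKAscending k w a b → IsKDescending k w c d → a ≤ c → d ≤ b → ⊥
  kDescending-not-inside-kAscending (_ , _ , _ , _ , _ , no-k-descent) (c<d , _ , _ , _ , c-d≥k , _) a≤c d≤b =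
    no-k-descent _ _ a≤c c<d d≤b c-d≥k

  kAscending-not-inside-kDescending : ∀ {a b c d} →
    IsKAscending k w a b → IsKDescending k w c d → c ≤ a → b ≤ d → ⊥
  kAscending-not-inside-kDescending (a<b , _ , _ , _ , b-a≥k , _) (_ , _ , _ , _ , _ , no-k-ascent) c≤a b≤d =
    no-k-ascent _ _ c≤a a<b b≤d b-a≥k

  kAscending-then-kDescending-meet : ∀ {a b c d} →
    IsKAscending k w a b → IsKDescending k w c d → a ≤ c → c ≤ b → b ≤ d → b ≡ c
  kAscending-then-kDescending-meet (_ , b<n , _ , b-max , _) (_ , _ , c-max , _) a≤c c≤b b≤d =
    val-injective w b<n (≤-<-trans c≤b b<n)
      (≤-antisym (c-max _ c≤b b≤d) (b-max _ a≤c c≤b))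

  kDescending-then-kAscending-meet : ∀ {a b c d} →
    IsKAscending k w a b → IsKDescending k w c d → c ≤ a → a ≤ d → d ≤ b → a ≡ d
  kDescending-then-kAscending-meet (a<b , b<n , a-min , _) (_ , d<n , _ , d-min , _) c≤a a≤d d≤b =
    val-injective w (<-≤-trans a<b (<⇒≤ b<n)) d<n
      (≤-antisym (a-min _ a≤d d≤b) (d-min _ c≤a a≤d))

  kAscending∩kDescending-no-two-points : ∀ {a b c d p q} →
    IsKAscending k w a b → IsKDescending k w c d → p < q →
    InSection a b p → InSection c d p → InSection a b q → InSection c d q → ⊥
  kAscending∩kDescending-no-two-points {a} {b} {c} {d} A D p<q (a≤p , p≤b) (c≤p , _) (_ , q≤b) (_ , q≤d)
    with ≤-total a c | ≤-total b d
  ... | inj₁ a≤c | inj₁ b≤d =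
    <-irrefl (sym (kAscending-then-kDescending-meet A D a≤c c≤b b≤d)) (≤-<-trans c≤p (<-≤-trans p<q q≤b))
    where c≤b = ≤-trans c≤p p≤b
  ... | inj₂ c≤a | inj₂ d≤b =
    <-irrefl (kDescending-then-kAscending-meet A D c≤a a≤d d≤b) (≤-<-trans a≤p (<-≤-trans p<q q≤d))
    where a≤d = ≤-trans a≤p (≤-trans (<⇒≤ p<q) q≤d)
  ... | inj₁ a≤c | inj₂ d≤b = kDescending-not-inside-kAscending A D a≤c d≤b
  ... | inj₂ c≤a | inj₁ b≤d = kAscending-not-inside-kDescending A D c≤a b≤d

  kAscending∩kDescending-subsingleton : ∀ {a b c d} →
    IsKAscending k w a b → IsKDescending k w c d →
    ∀ p q → InSection a b p → InSection c d p → InSection a b q → InSection c d q → p ≡ q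
  kAscending∩kDescending-subsingleton A D p q p∈ab p∈cd q∈ab q∈cd with <-cmp p q
  ... | tri< p<q _ _ = ⊥-elim (kAscending∩kDescending-no-two-points A D p<q p∈ab p∈cd q∈ab q∈cd)
  ... | tri≈ _ p≡q _ = p≡q
  ... | tri> _ _ q<p = ⊥-elim (kAscending∩kDescending-no-two-points A D q<p q∈ab q∈cd p∈ab p∈cd)

  kAscending-merge : ∀ {a b c d} → IsKAscending k w a b → IsKAscending k w c d →
    a ≤ c → c ≤ b → b ≤ d → IsKAscending k w a d
  kAscending-merge {a} {b} {c} {d}
    (a<b , _ , ab-min , ab-max , b-a≥k , ab-no-k-descent)
    (_ , d<n , cd-min , cd-max , _ , cd-no-k-descent) a≤c c≤b b≤d =
    <-≤-trans a<b b≤d , d<n , a-min , d-max , ≤-trans b-a≥k (cd-max _ c≤b b≤d) , no-k-descent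
    where
      a-min : ∀ x → a ≤ x → x ≤ d → val w a ≤ val w x
      a-min x a≤x x≤d with ≤-total x b
      ... | inj₁ x≤b = ab-min x a≤x x≤b
      ... | inj₂ b≤x = ≤-trans (ab-min c a≤c c≤b) (cd-min x (≤-trans c≤b b≤x) x≤d)
      d-max : ∀ x → a ≤ x → x ≤ d → val w x ≤ val w d
      d-max x a≤x x≤d with ≤-total c x
      ... | inj₁ c≤x = cd-max x c≤x x≤d
      ... | inj₂ x≤c = ≤-trans (ab-max x a≤x (≤-trans x≤c c≤b)) (cd-max b c≤b b≤d)
      -- A k-descent from s < c to t > b would already be one from s to c,
      -- since c is the minimum of the second section.
      no-k-descent : ∀ s t → a ≤ s → s < t → t ≤ d → ¬ (val w s ≥ val w t + k)
      no-k-descent s t a≤s s<t t≤d descent with t ≤? b | c ≤? s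
      ... | yes t≤b | _       = ab-no-k-descent s t a≤s s<t t≤b descent
      ... | no _    | yes c≤s = cd-no-k-descent s t c≤s s<t t≤d descent
      ... | no t≰b  | no c≰s  =
        ab-no-k-descent s c a≤s (≰⇒> c≰s) c≤b
          (≤-trans (+-monoˡ-≤ k (cd-min t (≤-trans c≤b (<⇒≤ (≰⇒> t≰b))) t≤d)) descent)

  maxKAscending-overlapping-≡ : ∀ {a b c d} →
    IsMaxKAscending k w a b → IsMaxKAscending k w c d →
    a ≤ c → ∀ p → InSection a b p → InSection c d p → a ≡ c × b ≡ d
  maxKAscending-overlapping-≡ {a} {b} {c} {d} (A , A-max) (C , C-max) a≤c p (_ , p≤b) (c≤p , _)
    with ≤-total b d
  ... | inj₂ d≤b = C-max a b A a≤c d≤b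
  ... | inj₁ b≤d with A-max a d merged ≤-refl b≤d | C-max a d merged a≤c ≤-refl
    where merged = kAscending-merge A C a≤c (≤-trans c≤p p≤b) b≤d
  ... | _ , d≡b | a≡c , _ = a≡c , sym d≡b

lemma2p6 : (n k : ℕ) → 2 ≤ n → 1 ≤ k → k < n → (w : Permutation′ n) →
    ((a b c d : ℕ) → IsMaxKAscending k w a b → IsMaxKDescending k w c d →
       ∀ p q → InSection a b p → InSection c d p → InSection a b q → InSection c d q → p ≡ q)
    × ((a b c d : ℕ) → IsMaxKAscending k w a b → IsMaxKAscending k w c d →
       ¬ (a ≡ c × b ≡ d) → ∀ p → InSection a b p → InSection c d p → ⊥)
lemma2p6 n k _ _ _ w =
  (λ a b c d (A , _) (D , _) → kAscending∩kDescending-subsingleton w A D) ,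
  distinct-disjoint
  where
    distinct-disjoint : (a b c d : ℕ) → IsMaxKAscending k w a b → IsMaxKAscending k w c d →
      ¬ (a ≡ c × b ≡ d) → ∀ p → InSection a b p → InSection c d p → ⊥
    distinct-disjoint a b c d A C sections-differ p p∈ab p∈cd with ≤-total a c
    ... | inj₁ a≤c = sections-differ (maxKAscending-overlapping-≡ w A C a≤c p p∈ab p∈cd)
    ... | inj₂ c≤a with maxKAscending-overlapping-≡ w C A c≤a p p∈cd p∈ab
    ... | c≡a , d≡b = sections-differ (sym c≡a , sym d≡b)
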